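{- Let $\alpha=x_1\cdots x_n$ be a sentential form and $\ell=\ell_1\cdots\ell_n\in\mathbb{N}^n$ a sequence of levels associated to $\alpha$. If there exists a choice function for $\alpha$ and $\ell$, then $\ell_j\neq0$ for every position $j$ such that $x_j$ is a non-terminal.
   Context: $G=(N_{\bigcirc}\,\dot\cup\,N_{\square},T,P)$ is a context-free grammar with disjoint finite sets of non-terminals $N=N_\bigcirc\cup N_\square$ and terminals $T$, finitely many rules $X\to\eta$, every non-terminal having a rule; $A=(T,Q,q_0,Q_F,\to)$ is a finite automaton. Boxes are subsets of $Q\times Q$, composed relationally ($\rho;\tau=\{(q,q''):\exists q'.(q,q')\in\rho,(q',q'')\in\tau\}$), $\mathrm{id}=\{(q,q)\}$, $[a]=\{(q,q'):q\xrightarrow{a}q'\}$. Formulas are CNF formulas: finite sets of clauses, each a finite set of boxes (conjunction of disjunctions); $\mathit{false}=\{\{\}\}$. Operations: $F\wedge G=F\cup G$; $F\vee G=\{K\cup H:K\in F,H\in G\}$; $F;G=\bigcup_{K\in F}\bigcup_{z:K\to G}\{\bigcup_{\rho\in K}\{\rho;\tau:\tau\in z(\rho)\}\}$. The Kleene approximants of the induced system are $\sigma^0(X)=\mathit{false}$ and, for each $X$ with rules $X\to\eta_1,\dots,X\to\eta_k$, $\sigma^{i+1}(X)=\bigwedge_j\sigma^i(\eta_j)$ if $X\in N_\square$ and $\bigvee_j\sigma^i(\eta_j)$ if $X\in N_\bigcirc$, where $\sigma^i(\varepsilon)=\{\{\mathrm{id}\}\}$, $\sigma^i(a)=\{\{[a]\}\}$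 for $a\in T$ and $\sigma^i(\alpha\beta)=\sigma^i(\alpha);\sigma^i(\beta)$. For a sentential form $\alpha=x_1\cdots x_n$ and $\ell=\ell_1\cdots\ell_n\in\mathbb{N}^n$, $\sigma^\ell(\alpha)=\sigma^{\ell_1}(x_1);\cdots;\sigma^{\ell_n}(x_n)$. A choice function on a CNF formula $F$ is a map $c$ with $c(K)\in K$ for every clause $K\in F$; a choice function for $\alpha$ and $\ell$ is a choice function on $\sigma^\ell(\alpha)$. -}

module Defs where

open import Data.Nat using (ℕ; zero; suc)
open import Data.Fin using (Fin; _≟_)
open import Data.Bool using (Bool; _∧_)
open import Data.List using (List; []; _∷_; map; concatMap; foldr; filterᵇ; _++_; allFin)
open import Data.Bool.ListAction using (any)
open import Data.List.Relation.Unary.Any using (Any)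
open import Data.List.Membership.Propositional using (_∈_)
open import Data.Vec using (Vec; toList; zipWith)
open import Data.Product using (Σ; Σ-syntax; _×_; _,_; proj₁; proj₂)
open import Data.Sum using (_⊎_; inj₁; inj₂)
open import Relation.Binary.PropositionalEquality using (_≡_)
open import Relation.Nullary.Decidable using (⌊_⌋)

-- Boxes over the state set Q = Fin m: subsets of Q × Q (as Bool-valued
-- characteristic functions).

Box : ℕ → Set
Box m = Fin m → Fin m → Bool

_⨾_ : ∀ {m} → Box m → Box m → Box m
(ρ ⨾ τ) q q″ = any (λ q′ → ρ q q′ ∧ τ q′ q″) (allFin _)

idBox : ∀ {m} → Box m
idBox q q′ = ⌊ q ≟ q′ ⌋

-- CNF formulas: finite sets of clauses, clauses finite sets of boxes.
-- Finite sets are represented by lists.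

Clause : ℕ → Set
Clause m = List (Box m)

Formula : ℕ → Set
Formula m = List (Clause m)

false : ∀ {m} → Formula m
false = [] ∷ []

_∧F_ : ∀ {m} → Formula m → Formula m → Formula m
F ∧F G = F ++ G

_∨F_ : ∀ {m} → Formula m → Formula m → Formula m
F ∨F G = concatMap (λ K → map (λ H → K ++ H) G) F

-- all maps z : K → G, each given as its graph (list of pairs (ρ , z ρ))
maps : ∀ {X Y : Set} → List X → List Y → List (List (X × Y))
maps []       G = [] ∷ []
maps (x ∷ xs) G = concatMap (λ H → map (λ z → (x , H) ∷ z) (maps xs G)) G

clauseOf : ∀ {m} → List (Box m × Clause m) → Clause m
clauseOf z = concatMap (λ p → map (λ τ → proj₁ p ⨾ τ) (proj₂ p)) z

_⨾F_ : ∀ {m} → Formula m → Formula m → Formula m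
F ⨾F G = concatMap (λ K → map clauseOf (maps K G)) F

seqF : ∀ {m} → List (Formula m) → Formula m
seqF []           = (idBox ∷ []) ∷ []
seqF (F ∷ [])     = F
seqF (F ∷ G ∷ Fs) = F ⨾F seqF (G ∷ Fs)

data Kind : Set where
  circle square : Kind

Sym : ℕ → ℕ → Set
Sym nN nT = Fin nN ⊎ Fin nT

record Grammar (nN nT : ℕ) : Set where
  field
    kind    : Fin nN → Kind
    rules   : List (Fin nN × List (Sym nN nT))
    hasRule : ∀ X → Any (λ r → proj₁ r ≡ X) rules

record Automaton (nT : ℕ) : Set where
  field
    states  : ℕ
    trans   : Fin nT → Box states       -- q —a→ q'  iff  trans a q q'
    q₀      : Fin states
    final   : Fin states → Bool

open Grammar
open Automaton

module Approximants {nN nT : ℕ} (G : Grammar nN nT) (A : Automaton nT) where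

  Fm : Set
  Fm = Formula (states A)

  termBox : Fin nT → Box (states A)
  termBox a = trans A a

  rhss : Fin nN → List (List (Sym nN nT))
  rhss X = map proj₂ (filterᵇ (λ r → ⌊ proj₁ r ≟ X ⌋) (rules G))

  combine : Kind → List Fm → Fm
  combine square = foldr _∧F_ []
  combine circle = foldr _∨F_ false

  σ : ℕ → Fin nN → Fm
  σsym : ℕ → Sym nN nT → Fm
  σsyms : ℕ → List (Sym nN nT) → List Fm

  σ zero    X = false
  σ (suc i) X = combine (kind G X) (map (λ η → seqF (σsyms i η)) (rhss X))

  σsym i (inj₁ X) = σ i X
  σsym i (inj₂ a) = (termBox a ∷ []) ∷ []

  σsyms i []       = []
  σsyms i (x ∷ xs) = σsym i x ∷ σsyms i xs

  σform : ℕ → List (Sym nN nT) → Fm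
  σform i α = seqF (σsyms i α)

  σlev : ∀ {n} → Vec (Sym nN nT) n → Vec ℕ n → Fm
  σlev α ℓ = seqF (toList (zipWith σsym ℓ α))

ChoiceFunction : ∀ {m} → Formula m → Set
ChoiceFunction {m} F = (K : Clause m) → K ∈ F → Σ[ ρ ∈ Box m ] ρ ∈ K

module Submission where

-- A choice function picks a box from every clause, so it cannot exist on a
-- formula containing the empty clause (which denotes `false`).  The lemma
-- therefore follows by showing that a level ℓⱼ = 0 at a non-terminal xⱼ
-- forces the empty clause into σ^ℓ(α):
--
--   * σ⁰(xⱼ) = false = {{}} contains the empty clause;
--   * in a composition F ; G the empty clause of F survives (choose the empty
--     map on it), and so does an empty clause of G, provided F has at least
--     one clause K (map every box of K to the empty clause);
--   * every approximant σⁱ(X) has at least one clause: false does, conjunction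
--     and disjunction preserve this, and conjunctions are non-empty because
--     every non-terminal has a rule.

open import Defs
open import Data.Nat using (ℕ; zero; suc)
open import Data.Fin using (Fin; _≟_) renaming (zero to fzero; suc to fsuc)
open import Data.Vec using (Vec; lookup; toList; zipWith; []; _∷_)
open import Data.Sum using (inj₁; inj₂)
open import Data.List using (List; []; _∷_; map; concatMap; foldr; _++_)
open import Data.List.Relation.Unary.Any using (Any; here; there)
open import Data.List.Relation.Unary.All as All using (All; []; _∷_)
open import Data.List.Relation.Unary.All.Properties as All using ()
open import Data.List.Membership.Propositional using (_∈_; find; lose)
open import Data.List.Membership.Propositional.Properties
  using (∈-map⁺; ∈-++⁺ˡ; ∈-++⁺ʳ; ∈-filter⁺; ∈-concatMap⁺)
open import Data.Product using (∃; _×_; _,_; proj₁; proj₂)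
open import Data.Bool using (T?)
open import Relation.Nullary using (¬_)
open import Relation.Nullary.Decidable using (⌊_⌋; fromWitness)
open import Relation.Binary.PropositionalEquality using (_≡_; _≢_; refl; subst)

open Grammar

∈-concatMap-intro : ∀ {A B : Set} (f : A → List B) {x : A} {y : B} {xs : List A} →
                    x ∈ xs → y ∈ f x → y ∈ concatMap f xs
∈-concatMap-intro f x∈xs y∈fx = ∈-concatMap⁺ f (lose x∈xs y∈fx)

module _ {m : ℕ} where

  HasClause : Formula m → Set
  HasClause F = ∃ λ K → K ∈ F

  no-choice : ∀ {F : Formula m} → [] ∈ F → ¬ ChoiceFunction F
  no-choice []∈F c with c [] []∈F
  ... | _ , ()

  constMap : Clause m → Clause m → List (Box m × Clause m)
  constMap K H = map (λ ρ → ρ , H) K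

  constMap∈maps : ∀ (K : Clause m) {H : Clause m} {G : Formula m} →
                  H ∈ G → constMap K H ∈ maps K G
  constMap∈maps []      H∈G = here refl
  constMap∈maps (ρ ∷ K) {H} {G} H∈G =
    ∈-concatMap-intro (λ H′ → map ((ρ , H′) ∷_) (maps K G)) H∈G
      (∈-map⁺ ((ρ , H) ∷_) (constMap∈maps K H∈G))

  clauseOf-constMap-[] : ∀ (K : Clause m) → clauseOf (constMap K []) ≡ []
  clauseOf-constMap-[] []      = refl
  clauseOf-constMap-[] (ρ ∷ K) = clauseOf-constMap-[] K

  clauseOf∈⨾ : ∀ {F G : Formula m} {K : Clause m} {z : List (Box m × Clause m)} →
               K ∈ F → z ∈ maps K G → clauseOf z ∈ (F ⨾F G)
  clauseOf∈⨾ {G = G} K∈F z∈maps =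
    ∈-concatMap-intro (λ K → map clauseOf (maps K G)) K∈F (∈-map⁺ clauseOf z∈maps)

  ⨾-hasClause : ∀ {F G : Formula m} → HasClause F → HasClause G → HasClause (F ⨾F G)
  ⨾-hasClause (K , K∈F) (H , H∈G) = _ , clauseOf∈⨾ K∈F (constMap∈maps K H∈G)

  -- An empty clause of F survives in F ; G (the only map on it is the empty one).
  ⨾-emptyˡ : ∀ {F G : Formula m} → [] ∈ F → [] ∈ (F ⨾F G)
  ⨾-emptyˡ []∈F = clauseOf∈⨾ []∈F (here refl)

  ⨾-emptyʳ : ∀ {F G : Formula m} → HasClause F → [] ∈ G → [] ∈ (F ⨾F G)
  ⨾-emptyʳ (K , K∈F) []∈G =
    subst (_∈ _) (clauseOf-constMap-[] K) (clauseOf∈⨾ K∈F (constMap∈maps K []∈G))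

  seqF-hasClause : ∀ {Fs : List (Formula m)} → All HasClause Fs → HasClause (seqF Fs)
  seqF-hasClause []                = _ , here refl
  seqF-hasClause (h ∷ [])          = h
  seqF-hasClause (h ∷ hs@(_ ∷ _)) = ⨾-hasClause h (seqF-hasClause hs)

  seqF-empty : ∀ {Fs : List (Formula m)} → All HasClause Fs → Any ([] ∈_) Fs → [] ∈ seqF Fs
  seqF-empty (_ ∷ [])         (here []∈F) = []∈F
  seqF-empty (_ ∷ _ ∷ _)      (here []∈F) = ⨾-emptyˡ []∈F
  seqF-empty (h ∷ hs@(_ ∷ _)) (there e)   = ⨾-emptyʳ h (seqF-empty hs e)

  ⋀-hasClause : ∀ {Fs : List (Formula m)} → Any HasClause Fs → HasClause (foldr _∧F_ [] Fs)
  ⋀-hasClause {F ∷ _}  (here (K , K∈F)) = K , ∈-++⁺ˡ K∈F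
  ⋀-hasClause {F ∷ _}  (there h)        = let K , K∈ = ⋀-hasClause h in K , ∈-++⁺ʳ F K∈

  ⋁-hasClause : ∀ {Fs : List (Formula m)} → All HasClause Fs → HasClause (foldr _∨F_ false Fs)
  ⋁-hasClause []                   = _ , here refl
  ⋁-hasClause ((K , K∈F) ∷ hs) with ⋁-hasClause hs
  ... | H , H∈ = _ , ∈-concatMap-intro _ K∈F (∈-map⁺ (K ++_) H∈)

module ApproximantClauses {nN nT : ℕ} (G : Grammar nN nT) (A : Automaton nT) where
  open Approximants G A

  rhs-exists : ∀ X → ∃ λ η → η ∈ rhss X
  rhs-exists X with find (hasRule G X)
  ... | (_ , η) , r∈rules , refl =
    η , ∈-map⁺ proj₂ (∈-filter⁺ (λ r → T? ⌊ proj₁ r ≟ X ⌋) r∈rules (fromWitness refl))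

  σ-hasClause     : ∀ i X → HasClause (σ i X)
  σsym-hasClause  : ∀ i x → HasClause (σsym i x)
  σsyms-hasClause : ∀ i α → All HasClause (σsyms i α)
  alternatives    : ∀ i X → All HasClause (map (λ η → seqF (σsyms i η)) (rhss X))

  σ-hasClause zero    X = _ , here refl
  σ-hasClause (suc i) X with kind G X
  ... | circle = ⋁-hasClause (alternatives i X)
  ... | square = let η , η∈rhss = rhs-exists X
                     η∈alts = ∈-map⁺ (λ η → seqF (σsyms i η)) η∈rhss
                 in ⋀-hasClause (lose η∈alts (All.lookup (alternatives i X) η∈alts))

  σsym-hasClause i (inj₁ X) = σ-hasClause i X
  σsym-hasClause i (inj₂ a) = _ , here refl

  σsyms-hasClause i []      = []
  σsyms-hasClause i (x ∷ α) = σsym-hasClause i x ∷ σsyms-hasClause i α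

  alternatives i X =
    All.map⁺ (All.universal (λ η → seqF-hasClause (σsyms-hasClause i η)) (rhss X))

  levels-hasClause : ∀ {n} (α : Vec (Sym nN nT) n) (ℓ : Vec ℕ n) →
                     All HasClause (toList (zipWith σsym ℓ α))
  levels-hasClause []      []      = []
  levels-hasClause (x ∷ α) (l ∷ ℓ) = σsym-hasClause l x ∷ levels-hasClause α ℓ

  level-zero-empty : ∀ {n} (α : Vec (Sym nN nT) n) (ℓ : Vec ℕ n) (j : Fin n) (X : Fin nN) →
                     lookup α j ≡ inj₁ X → lookup ℓ j ≡ 0 →
                     Any ([] ∈_) (toList (zipWith σsym ℓ α))
  level-zero-empty (_ ∷ _) (_ ∷ _) fzero    X refl refl = here (here refl)
  level-zero-empty (_ ∷ α) (_ ∷ ℓ) (fsuc j) X αj≡X ℓj≡0 =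
    there (level-zero-empty α ℓ j X αj≡X ℓj≡0)

lemma25 : ∀ {nN nT} (G : Grammar nN nT) (A : Automaton nT) {n : ℕ}
          (α : Vec (Sym nN nT) n) (ℓ : Vec ℕ n) →
          ChoiceFunction (Approximants.σlev G A α ℓ) →
          ∀ (j : Fin n) (X : Fin nN) → lookup α j ≡ inj₁ X → lookup ℓ j ≢ 0
lemma25 G A α ℓ choice j X αj≡X ℓj≡0 =
  no-choice (seqF-empty (levels-hasClause α ℓ) (level-zero-empty α ℓ j X αj≡X ℓj≡0)) choice
  where open ApproximantClauses G A
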